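{- There is an absolute constant $c>0$ such that if a $3$-uniform multihypergraph has a $2$-cut with excess $x\ge 0$, then it has a $3$-cut with excess at least $cx$.
   Context: A $3$-uniform multihypergraph has a vertex set and a multiset of $3$-element vertex subsets (edges); let $m$ be the number of edges. An $r$-cut is a partition of the vertex set into $r$ labelled parts; its size is the number of edges having a vertex in every part. The excess of a $2$-cut is its size minus $\frac34 m$, and the excess of a $3$-cut is its size minus $\frac{6}{27}m$ (these are the expected sizes of uniformly random cuts). -}

module Defs where

open import Data.Nat using (ℕ)
open import Data.Fin using (Fin)
open import Data.Fin.Properties using (_≟_)
open import Data.Product using (_×_; _,_)
open import Data.List using (List; length; filter)
open import Data.Sum using (_⊎_)
open import Relation.Nullary using (¬_; Dec)
open import Relation.Nullary.Decidable using (_⊎-dec_)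
open import Relation.Binary.PropositionalEquality using (_≡_)
open import Data.Fin.Properties using (all?)
open import Data.Rational using (ℚ; _-_; _*_; _/_)
import Data.Rational as ℚ
open import Data.Integer using (+_)

-- A 3-element vertex subset of the vertex set Fin n, given as a triple of
-- pairwise distinct vertices (order irrelevant for everything below).
record Triple (n : ℕ) : Set where
  constructor triple
  field
    v₁ v₂ v₃ : Fin n
    v₁≢v₂ : ¬ v₁ ≡ v₂
    v₁≢v₃ : ¬ v₁ ≡ v₃
    v₂≢v₃ : ¬ v₂ ≡ v₃

-- A 3-uniform multihypergraph on vertex set Fin n: a finite multiset
-- (list, repetitions allowed) of 3-element subsets.
Hypergraph3 : ℕ → Set
Hypergraph3 n = List (Triple n)

edges : ∀ {n} → Hypergraph3 n → ℕ
edges H = length H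

Cut : ℕ → ℕ → Set
Cut n r = Fin n → Fin r

Meets : ∀ {n r} → Cut n r → Triple n → Fin r → Set
Meets f (triple a b c _ _ _) i = (f a ≡ i) ⊎ ((f b ≡ i) ⊎ (f c ≡ i))

meets? : ∀ {n r} (f : Cut n r) (e : Triple n) (i : Fin r) → Dec (Meets f e i)
meets? f (triple a b c _ _ _) i = (f a ≟ i) ⊎-dec ((f b ≟ i) ⊎-dec (f c ≟ i))

IsCut : ∀ {n r} → Cut n r → Triple n → Set
IsCut {r = r} f e = ∀ (i : Fin r) → Meets f e i

isCut? : ∀ {n r} (f : Cut n r) (e : Triple n) → Dec (IsCut f e)
isCut? f e = all? (meets? f e)

cutSize : ∀ {n r} → Hypergraph3 n → Cut n r → ℕ
cutSize H f = length (filter (isCut? f) H)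

excess2 : ∀ {n} → Hypergraph3 n → Cut n 2 → ℚ
excess2 H f = (+ cutSize H f ℚ./ 1) - ((+ 3 ℚ./ 4) * (+ edges H ℚ./ 1))

excess3 : ∀ {n} → Hypergraph3 n → Cut n 3 → ℚ
excess3 H g = (+ cutSize H g ℚ./ 1) - ((+ 6 ℚ./ 27) * (+ edges H ℚ./ 1))

-- Place the vertices independently at random into the parts of a 3-cut: a vertex
-- on side 0 of the 2-cut goes to part 1 or 2 with probabilities 1/3 and 2/3, a
-- vertex on side 1 to part 0 or 1 with probabilities 2/3 and 1/3.  An edge that the
-- 2-cut does not cut then never meets all three parts, while a cut edge does so with
-- probability 8/27.  Hence the expected 3-cut has size (8/27) s for a 2-cut of size s,
-- and as (8/27)(3/4) = 6/27 its expected excess is 8/27 times the excess of the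
-- 2-cut.  Fixing the vertices one at a time by conditional expectations yields an
-- actual 3-cut at least as large as this expectation.
module Submission where

module FractionalCuts where

  open import Defs
  open import Data.Nat using (ℕ; zero; suc; _+_; _*_; _≤_; _⊔_)
  open import Data.Nat.Properties
    using (≤-trans; ≤-reflexive; +-mono-≤; *-monoʳ-≤; *-suc; *-zeroʳ; *-distribˡ-+; *-cancelˡ-≤; ⊔-sel; m≤m⊔n; m≤n⊔m)
  import Data.Nat.Properties as ℕ
  open import Data.Nat.Solver using (module +-*-Solver)
  open import Data.Fin using (Fin; zero; suc)
  open import Data.Fin.Properties using (_≟_; all?)
  open import Data.Product using (Σ; _×_; _,_; proj₁; proj₂; ∃-syntax)
  open import Data.Sum using (_⊎_; inj₁; inj₂)
  open import Data.Bool using (true; false; if_then_else_)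
  open import Data.List using (List; []; _∷_; length; filter; map; allFin)
  open import Data.List.Properties using (map-cong)
  open import Data.Nat.ListAction using (sum)
  open import Data.List.Relation.Unary.Any using (here; there)
  open import Data.List.Membership.Propositional using (_∈_)
  open import Data.List.Membership.Propositional.Properties using (∈-allFin)
  open import Data.Vec.Functional using (updateAt)
  open import Data.Vec.Functional.Properties using (updateAt-updates; updateAt-minimal)
  open import Function using (_∘_; const)
  open import Relation.Nullary using (Dec; yes; no; does; contradiction)
  open import Relation.Nullary.Decidable using (from-yes; _⊎-dec_)
  open import Relation.Unary using (Decidable)
  open import Relation.Binary.PropositionalEquality
    using (_≡_; _≢_; refl; sym; trans; cong; cong₂; subst₂; module ≡-Reasoning)

  Weights : Set
  Weights = ℕ × ℕ × ℕ

  total : Weights → ℕ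
  total (p₀ , p₁ , p₂) = p₀ + p₁ + p₂

  _·_ : Weights → (Fin 3 → ℕ) → ℕ
  (p₀ , p₁ , p₂) · A = p₀ * A zero + p₁ * A (suc zero) + p₂ * A (suc (suc zero))

  ·-cong : ∀ p {A B} → (∀ i → A i ≡ B i) → p · A ≡ p · B
  ·-cong (p₀ , p₁ , p₂) A≗B =
    cong₂ _+_ (cong₂ _+_ (cong (p₀ *_) (A≗B zero)) (cong (p₁ *_) (A≗B (suc zero))))
              (cong (p₂ *_) (A≗B (suc (suc zero))))

  ·-mono-≤ : ∀ p {A B} → (∀ i → A i ≤ B i) → p · A ≤ p · B
  ·-mono-≤ (p₀ , p₁ , p₂) A≤B =
    +-mono-≤ (+-mono-≤ (*-monoʳ-≤ p₀ (A≤B zero)) (*-monoʳ-≤ p₁ (A≤B (suc zero))))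
             (*-monoʳ-≤ p₂ (A≤B (suc (suc zero))))

  module _ where
    open +-*-Solver

    ·-const : ∀ p X → p · const X ≡ total p * X
    ·-const (p₀ , p₁ , p₂) X =
      solve 4 (λ p₀ p₁ p₂ X → p₀ :* X :+ p₁ :* X :+ p₂ :* X := (p₀ :+ p₁ :+ p₂) :* X)
        refl p₀ p₁ p₂ X

    ·-distrib-+ : ∀ p A B → p · (λ i → A i + B i) ≡ p · A + p · B
    ·-distrib-+ (p₀ , p₁ , p₂) A B =
      solve 9 (λ p₀ p₁ p₂ a₀ a₁ a₂ b₀ b₁ b₂ →
          p₀ :* (a₀ :+ b₀) :+ p₁ :* (a₁ :+ b₁) :+ p₂ :* (a₂ :+ b₂)
        := (p₀ :* a₀ :+ p₁ :* a₁ :+ p₂ :* a₂) :+ (p₀ :* b₀ :+ p₁ :* b₁ :+ p₂ :* b₂))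
        refl p₀ p₁ p₂ (A zero) (A (suc zero)) (A (suc (suc zero)))
                      (B zero) (B (suc zero)) (B (suc (suc zero)))

  Distribution : Set
  Distribution = Σ Weights (λ p → total p ≡ 3)

  weights : Distribution → Weights
  weights = proj₁

  argmax₃ : (A : Fin 3 → ℕ) → ∃[ i ] (∀ j → A j ≤ A i)
  argmax₃ A = select (⊔-sel (a₀ ⊔ a₁) a₂) (⊔-sel a₀ a₁)
    where
    a₀ a₁ a₂ M : ℕ
    a₀ = A zero
    a₁ = A (suc zero)
    a₂ = A (suc (suc zero))
    M = a₀ ⊔ a₁ ⊔ a₂
    below : ∀ j → A j ≤ M
    below zero = ≤-trans (m≤m⊔n a₀ a₁) (m≤m⊔n (a₀ ⊔ a₁) a₂)
    below (suc zero) = ≤-trans (m≤n⊔m a₀ a₁) (m≤m⊔n (a₀ ⊔ a₁) a₂)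
    below (suc (suc zero)) = m≤n⊔m (a₀ ⊔ a₁) a₂
    attains : ∀ i → A i ≡ M → ∃[ i ] (∀ j → A j ≤ A i)
    attains i eq = i , λ j → ≤-trans (below j) (≤-reflexive (sym eq))
    select : (M ≡ a₀ ⊔ a₁) ⊎ (M ≡ a₂) → (a₀ ⊔ a₁ ≡ a₀) ⊎ (a₀ ⊔ a₁ ≡ a₁) → ∃[ i ] (∀ j → A j ≤ A i)
    select (inj₂ eq) _          = attains (suc (suc zero)) (sym eq)
    select (inj₁ eq) (inj₁ eq′) = attains zero (sym (trans eq eq′))
    select (inj₁ eq) (inj₂ eq′) = attains (suc zero) (sym (trans eq eq′))

  average-attained : ∀ (d : Distribution) A X → weights d · A ≡ 3 * X → ∃[ i ] X ≤ A i
  average-attained (p , total≡3) A X avg with argmax₃ A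
  ... | i , maximal = i , *-cancelˡ-≤ 3 (begin
    3 * X                  ≡⟨ sym avg ⟩
    p · A                  ≤⟨ ·-mono-≤ p maximal ⟩
    p · const (A i)        ≡⟨ ·-const p (A i) ⟩
    total p * A i          ≡⟨ cong (_* A i) total≡3 ⟩
    3 * A i                ∎)
    where open ℕ.≤-Reasoning

  point : Fin 3 → Distribution
  point zero             = (3 , 0 , 0) , refl
  point (suc zero)       = (0 , 3 , 0) , refl
  point (suc (suc zero)) = (0 , 0 , 3) , refl

  -- Stated for arbitrary operations so that the ring solver below can be handed the
  -- very same expression over its polynomials.
  permanentOver : {A : Set} → (A → A → A) → (A → A → A) → A × A × A → A × A × A → A × A × A → A
  permanentOver _⊕_ _⊗_ (x₀ , x₁ , x₂) (y₀ , y₁ , y₂) (z₀ , z₁ , z₂) =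
    ((x₀ ⊗ ((y₁ ⊗ z₂) ⊕ (y₂ ⊗ z₁))) ⊕ (x₁ ⊗ ((y₀ ⊗ z₂) ⊕ (y₂ ⊗ z₀)))) ⊕ (x₂ ⊗ ((y₀ ⊗ z₁) ⊕ (y₁ ⊗ z₀)))

  permanent : Weights → Weights → Weights → ℕ
  permanent = permanentOver _+_ _*_

  module _ where
    open +-*-Solver

    private
      perm : ∀ {k} → Polynomial k × Polynomial k × Polynomial k → Polynomial k × Polynomial k × Polynomial k →
             Polynomial k × Polynomial k × Polynomial k → Polynomial k
      perm = permanentOver _:+_ _:*_

      e₀ e₁ e₂ : ∀ {k} → Polynomial k × Polynomial k × Polynomial k
      e₀ = con 3 , con 0 , con 0
      e₁ = con 0 , con 3 , con 0
      e₂ = con 0 , con 0 , con 3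

    permanent-linear₁ : ∀ p y z → p · (λ i → permanent (weights (point i)) y z) ≡ 3 * permanent p y z
    permanent-linear₁ (p₀ , p₁ , p₂) (y₀ , y₁ , y₂) (z₀ , z₁ , z₂) =
      solve 9 (λ p₀ p₁ p₂ y₀ y₁ y₂ z₀ z₁ z₂ → let p = p₀ , p₁ , p₂ ; y = y₀ , y₁ , y₂ ; z = z₀ , z₁ , z₂ in
          p₀ :* perm e₀ y z :+ p₁ :* perm e₁ y z :+ p₂ :* perm e₂ y z := con 3 :* perm p y z)
        refl p₀ p₁ p₂ y₀ y₁ y₂ z₀ z₁ z₂

    permanent-linear₂ : ∀ p x z → p · (λ i → permanent x (weights (point i)) z) ≡ 3 * permanent x p z
    permanent-linear₂ (p₀ , p₁ , p₂) (x₀ , x₁ , x₂) (z₀ , z₁ , z₂) =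
      solve 9 (λ p₀ p₁ p₂ x₀ x₁ x₂ z₀ z₁ z₂ → let p = p₀ , p₁ , p₂ ; x = x₀ , x₁ , x₂ ; z = z₀ , z₁ , z₂ in
          p₀ :* perm x e₀ z :+ p₁ :* perm x e₁ z :+ p₂ :* perm x e₂ z := con 3 :* perm x p z)
        refl p₀ p₁ p₂ x₀ x₁ x₂ z₀ z₁ z₂

    permanent-linear₃ : ∀ p x y → p · (λ i → permanent x y (weights (point i))) ≡ 3 * permanent x y p
    permanent-linear₃ (p₀ , p₁ , p₂) (x₀ , x₁ , x₂) (y₀ , y₁ , y₂) =
      solve 9 (λ p₀ p₁ p₂ x₀ x₁ x₂ y₀ y₁ y₂ → let p = p₀ , p₁ , p₂ ; x = x₀ , x₁ , x₂ ; y = y₀ , y₁ , y₂ in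
          p₀ :* perm x y e₀ :+ p₁ :* perm x y e₁ :+ p₂ :* perm x y e₂ := con 3 :* perm x y p)
        refl p₀ p₁ p₂ x₀ x₁ x₂ y₀ y₁ y₂

  spread : Fin 2 → Distribution
  spread zero       = (0 , 1 , 2) , refl
  spread (suc zero) = (2 , 1 , 0) , refl

  rainbow? : ∀ {r} (x y z : Fin r) → Dec (∀ i → (x ≡ i) ⊎ ((y ≡ i) ⊎ (z ≡ i)))
  rainbow? x y z = all? λ i → (x ≟ i) ⊎-dec ((y ≟ i) ⊎-dec (z ≟ i))

  permanent-points : ∀ x y z →
    permanent (weights (point x)) (weights (point y)) (weights (point z))
      ≡ (if does (rainbow? x y z) then 27 else 0)
  permanent-points = from-yes (all? λ x → all? λ y → all? λ z →
    permanent (weights (point x)) (weights (point y)) (weights (point z))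
      ℕ.≟ (if does (rainbow? x y z) then 27 else 0))

  permanent-spreads : ∀ x y z →
    permanent (weights (spread x)) (weights (spread y)) (weights (spread z))
      ≡ (if does (rainbow? x y z) then 8 else 0)
  permanent-spreads = from-yes (all? λ x → all? λ y → all? λ z →
    permanent (weights (spread x)) (weights (spread y)) (weights (spread z))
      ℕ.≟ (if does (rainbow? x y z) then 8 else 0))

  sum-map-indicator : ∀ {A : Set} {P : A → Set} (P? : Decidable P) c (w : A → ℕ) →
    (∀ x → w x ≡ (if does (P? x) then c else 0)) →
    ∀ xs → sum (map w xs) ≡ c * length (filter P? xs)
  sum-map-indicator P? c w w≡ [] = sym (*-zeroʳ c)
  sum-map-indicator P? c w w≡ (x ∷ xs) rewrite w≡ x with does (P? x)
  ... | true  = trans (cong (c +_) (sum-map-indicator P? c w w≡ xs)) (sym (*-suc c _))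
  ... | false = sum-map-indicator P? c w w≡ xs

  FracCut : ℕ → Set
  FracCut n = Fin n → Distribution

  edgeWeight : ∀ {n} → FracCut n → Triple n → ℕ
  edgeWeight μ (triple a b c _ _ _) = permanent (weights (μ a)) (weights (μ b)) (weights (μ c))

  -- 27 times the expected size of the random 3-cut that puts w into part i with
  -- probability (weights (μ w))ᵢ / 3: the permanent of the three weight vectors of an
  -- edge is 27 times the probability that its vertices land in three different parts.
  fracCutSize : ∀ {n} → FracCut n → Hypergraph3 n → ℕ
  fracCutSize μ H = sum (map (edgeWeight μ) H)

  fracCutSize-points : ∀ {n} (H : Hypergraph3 n) (g : Cut n 3) → fracCutSize (point ∘ g) H ≡ 27 * cutSize H g
  fracCutSize-points H g =
    sum-map-indicator (isCut? g) 27 (edgeWeight (point ∘ g))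
      (λ { (triple a b c _ _ _) → permanent-points (g a) (g b) (g c) }) H

  fracCutSize-spreads : ∀ {n} (H : Hypergraph3 n) (f : Cut n 2) → fracCutSize (spread ∘ f) H ≡ 8 * cutSize H f
  fracCutSize-spreads H f =
    sum-map-indicator (isCut? f) 8 (edgeWeight (spread ∘ f))
      (λ { (triple a b c _ _ _) → permanent-spreads (f a) (f b) (f c) }) H

  permanent-cong : ∀ {x x′ y y′ z z′} → x ≡ x′ → y ≡ y′ → z ≡ z′ → permanent x y z ≡ permanent x′ y′ z′
  permanent-cong refl refl refl = refl

  fracCutSize-cong : ∀ {n} {μ ν : FracCut n} → (∀ w → μ w ≡ ν w) → ∀ H → fracCutSize μ H ≡ fracCutSize ν H
  fracCutSize-cong {μ = μ} {ν} μ≗ν = cong sum ∘ map-cong edgeWeight-cong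
    where
    edgeWeight-cong : ∀ e → edgeWeight μ e ≡ edgeWeight ν e
    edgeWeight-cong (triple a b c _ _ _) =
      permanent-cong (cong weights (μ≗ν a)) (cong weights (μ≗ν b)) (cong weights (μ≗ν c))

  place : ∀ {n} → FracCut n → Fin n → Fin 3 → FracCut n
  place μ v i = updateAt μ v (const (point i))

  module _ {n} (μ : FracCut n) (v : Fin n) where

    private
      placed-here : ∀ i → weights (place μ v i v) ≡ weights (point i)
      placed-here i = cong weights (updateAt-updates v μ)

      placed-elsewhere : ∀ {w} → w ≢ v → ∀ i → weights (place μ v i w) ≡ weights (μ w)
      placed-elsewhere {w} w≢v i = cong weights (updateAt-minimal w v μ w≢v)

      p : Weights
      p = weights (μ v)

    -- Linearity in the weights of v needs v to occur at most once in the edge; this is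
    -- where the vertices of a Triple being distinct is used.
    edgeWeight-average : ∀ e → p · (λ i → edgeWeight (place μ v i) e) ≡ 3 * edgeWeight μ e
    edgeWeight-average (triple a b c a≢b a≢c b≢c) with a ≟ v | b ≟ v | c ≟ v
    ... | yes refl | _ | _ = trans
      (·-cong p λ i → permanent-cong (placed-here i) (placed-elsewhere (a≢b ∘ sym) i) (placed-elsewhere (a≢c ∘ sym) i))
      (permanent-linear₁ p (weights (μ b)) (weights (μ c)))
    ... | no a≢v | yes refl | _ = trans
      (·-cong p λ i → permanent-cong (placed-elsewhere a≢v i) (placed-here i) (placed-elsewhere (b≢c ∘ sym) i))
      (permanent-linear₂ p (weights (μ a)) (weights (μ c)))
    ... | no a≢v | no b≢v | yes refl = trans
      (·-cong p λ i → permanent-cong (placed-elsewhere a≢v i) (placed-elsewhere b≢v i) (placed-here i))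
      (permanent-linear₃ p (weights (μ a)) (weights (μ b)))
    ... | no a≢v | no b≢v | no c≢v = begin
      p · (λ i → edgeWeight (place μ v i) e)   ≡⟨ ·-cong p (λ i → permanent-cong (placed-elsewhere a≢v i) (placed-elsewhere b≢v i) (placed-elsewhere c≢v i)) ⟩
      p · const (edgeWeight μ e)               ≡⟨ ·-const p (edgeWeight μ e) ⟩
      total p * edgeWeight μ e                 ≡⟨ cong (_* edgeWeight μ e) (proj₂ (μ v)) ⟩
      3 * edgeWeight μ e                       ∎
      where
      open ≡-Reasoning
      e : Triple n
      e = triple a b c a≢b a≢c b≢c

    fracCutSize-average : ∀ H → p · (λ i → fracCutSize (place μ v i) H) ≡ 3 * fracCutSize μ H
    fracCutSize-average [] = trans (·-const p 0) (*-zeroʳ (total p))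
    fracCutSize-average (e ∷ H) = begin
      p · (λ i → edgeWeight (place μ v i) e + fracCutSize (place μ v i) H)
        ≡⟨ ·-distrib-+ p (λ i → edgeWeight (place μ v i) e) (λ i → fracCutSize (place μ v i) H) ⟩
      p · (λ i → edgeWeight (place μ v i) e) + p · (λ i → fracCutSize (place μ v i) H)
        ≡⟨ cong₂ _+_ (edgeWeight-average e) (fracCutSize-average H) ⟩
      3 * edgeWeight μ e + 3 * fracCutSize μ H
        ≡⟨ sym (*-distribˡ-+ 3 (edgeWeight μ e) (fracCutSize μ H)) ⟩
      3 * fracCutSize μ (e ∷ H) ∎
      where open ≡-Reasoning

    place-without-loss : ∀ H → ∃[ i ] fracCutSize μ H ≤ fracCutSize (place μ v i) H
    place-without-loss H = average-attained (μ v) _ _ (fracCutSize-average H)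

  IsPoint : Distribution → Set
  IsPoint d = ∃[ i ] d ≡ point i

  module _ {n} (H : Hypergraph3 n) where

    round : ∀ (L : List (Fin n)) (μ : FracCut n) → (∀ w → w ∈ L ⊎ IsPoint (μ w)) →
      ∃[ g ] fracCutSize μ H ≤ fracCutSize (point ∘ g) H
    round [] μ settled = proj₁ ∘ isPoint , ≤-reflexive (fracCutSize-cong (proj₂ ∘ isPoint) H)
      where
      isPoint : ∀ w → IsPoint (μ w)
      isPoint w with settled w
      ... | inj₂ μw≡point = μw≡point
    round (v ∷ L) μ settled =
      let i , μ≤μᵢ = place-without-loss μ v H
          g , μᵢ≤g = round L (place μ v i) (still-settled i)
      in g , ≤-trans μ≤μᵢ μᵢ≤g
      where
      still-settled : ∀ i w → w ∈ L ⊎ IsPoint (place μ v i w)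
      still-settled i w with w ≟ v | settled w
      ... | yes refl | _                   = inj₂ (i , updateAt-updates v μ)
      ... | no w≢v   | inj₁ (here w≡v)     = contradiction w≡v w≢v
      ... | no _     | inj₁ (there w∈L)    = inj₁ w∈L
      ... | no w≢v   | inj₂ (j , μw≡pointj) = inj₂ (j , trans (updateAt-minimal w v μ w≢v) μw≡pointj)

    derandomise : ∀ μ → ∃[ g ] fracCutSize μ H ≤ fracCutSize (point ∘ g) H
    derandomise μ = round (allFin n) μ (inj₁ ∘ ∈-allFin)

  three-cut-from-two-cut : ∀ {n} (H : Hypergraph3 n) (f : Cut n 2) → ∃[ g ] 8 * cutSize H f ≤ 27 * cutSize H g
  three-cut-from-two-cut H f =
    let g , spread≤g = derandomise H (spread ∘ f)
    in g , subst₂ _≤_ (fracCutSize-spreads H f) (fracCutSize-points H g) spread≤g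

open import Defs
open import Data.Nat using (ℕ)
open import Data.Product using (Σ; _×_; ∃-syntax; _,_)
open import Data.Rational using (ℚ; 0ℚ; _<_; _≤_; _*_)
import Data.Nat as ℕ
open import Data.Integer as ℤ using (+_)
import Data.Integer.Properties as ℤ
open import Data.Rational using (_+_; _-_; _/_; -_; toℚᵘ)
open import Data.Rational.Properties
  using (toℚᵘ-cancel-≤; toℚᵘ-homo-*; toℚᵘ-fromℚᵘ; *-distribˡ-+; neg-distribʳ-*; *-assoc; +-monoˡ-≤; positive⁻¹)
import Data.Rational.Unnormalised as ℚᵘ
open import Data.Rational.Unnormalised.Properties using (*-congˡ)
open import Relation.Binary.PropositionalEquality using (_≡_; cong; sym; trans; subst; subst₂; module ≡-Reasoning)
open FractionalCuts using (three-cut-from-two-cut)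

scaled-natural-≤ : ∀ a b → 8 ℕ.* a ℕ.≤ 27 ℕ.* b → (+ 8 / 27) * (+ a / 1) ≤ + b / 1
scaled-natural-≤ a b 8a≤27b = toℚᵘ-cancel-≤ (begin
  toℚᵘ ((+ 8 / 27) * (+ a / 1))          ≃⟨ toℚᵘ-homo-* (+ 8 / 27) (+ a / 1) ⟩
  toℚᵘ (+ 8 / 27) ℚᵘ.* toℚᵘ (+ a / 1)    ≃⟨ *-congˡ {toℚᵘ (+ 8 / 27)} (toℚᵘ-fromℚᵘ (ℚᵘ.mkℚᵘ (+ a) 0)) ⟩
  ℚᵘ.mkℚᵘ (+ 8) 26 ℚᵘ.* ℚᵘ.mkℚᵘ (+ a) 0  ≤⟨ ℚᵘ.*≤* cross ⟩
  ℚᵘ.mkℚᵘ (+ b) 0                        ≃⟨ toℚᵘ-fromℚᵘ (ℚᵘ.mkℚᵘ (+ b) 0) ⟨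
  toℚᵘ (+ b / 1)                         ∎)
  where
  open Data.Rational.Unnormalised.Properties.≤-Reasoning
  cross : (+ 8 ℤ.* + a) ℤ.* + 1 ℤ.≤ + b ℤ.* + 27
  cross = subst₂ ℤ._≤_ (sym 8a≡) (sym 27b≡) (ℤ.+≤+ 8a≤27b)
    where
    8a≡ : + 8 ℤ.* + a ℤ.* + 1 ≡ + (8 ℕ.* a)
    8a≡ = trans (ℤ.*-identityʳ (+ 8 ℤ.* + a)) (sym (ℤ.pos-* 8 a))
    27b≡ : + b ℤ.* + 27 ≡ + (27 ℕ.* b)
    27b≡ = trans (ℤ.*-comm (+ b) (+ 27)) (sym (ℤ.pos-* 27 b))

excess-scaling : ∀ s t m → 8 ℕ.* s ℕ.≤ 27 ℕ.* t →
  (+ 8 / 27) * (+ s / 1 - (+ 3 / 4) * (+ m / 1)) ≤ + t / 1 - (+ 6 / 27) * (+ m / 1)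
excess-scaling s t m 8s≤27t = subst (_≤ + t / 1 - (+ 6 / 27) * M) (sym distribute)
  (+-monoˡ-≤ (- ((+ 6 / 27) * M)) (scaled-natural-≤ s t 8s≤27t))
  where
  S M : ℚ
  S = + s / 1
  M = + m / 1
  distribute : (+ 8 / 27) * (S - (+ 3 / 4) * M) ≡ (+ 8 / 27) * S - (+ 6 / 27) * M
  distribute = begin
    (+ 8 / 27) * (S - (+ 3 / 4) * M)                ≡⟨ *-distribˡ-+ (+ 8 / 27) S (- ((+ 3 / 4) * M)) ⟩
    (+ 8 / 27) * S + (+ 8 / 27) * - ((+ 3 / 4) * M) ≡⟨ cong (_+_ ((+ 8 / 27) * S)) (sym (neg-distribʳ-* (+ 8 / 27) ((+ 3 / 4) * M))) ⟩
    (+ 8 / 27) * S - (+ 8 / 27) * ((+ 3 / 4) * M)   ≡⟨ cong (λ x → (+ 8 / 27) * S - x) (sym (*-assoc (+ 8 / 27) (+ 3 / 4) M)) ⟩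
    (+ 8 / 27) * S - (+ 6 / 27) * M                 ∎
    where open ≡-Reasoning

lemma5p4 : Σ ℚ λ c → (0ℚ < c) ×
               ((n : ℕ) (H : Hypergraph3 n) (f : Cut n 2) →
                 0ℚ ≤ excess2 H f →
                 ∃[ g ] (c * excess2 H f ≤ excess3 H g))
-- The bound holds for every 2-cut.
lemma5p4 = + 8 / 27 , positive⁻¹ (+ 8 / 27) , λ n H f _ →
  let g , 8f≤27g = three-cut-from-two-cut H f
  in g , excess-scaling (cutSize H f) (cutSize H g) (edges H) 8f≤27g
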